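{- Let $u=(u_1,u_2,\ldots)$ be a sequence of nonnegative integers that is eventually zero, let $w=\sum_i iu_i$, $d=\sum_i u_i$, and $\nu(u)=\sum_i u_i\,\nu(i+1)$. Let $n$ be an integer with $w\le n$. Then $n-\nu(u)\ge n-w+(w-d)/2$, and $n-\nu(u)=(w-d)/2$ if and only if $n=w$ and $u_i=0$ for all $i\notin\{1,3\}$.
   Context: $\nu$ denotes the $2$-adic valuation of an integer. The sequence $u$ is regarded as a partition of $w$ in which $u_i$ is the multiplicity of the part $i$, and $d$ is the number of parts. -}

module Defs where

open import Data.Nat using (ℕ; zero; suc; _+_; _*_; _%_; _/_)
open import Data.Nat.Properties using (_≟_)
open import Data.List using (List; []; _∷_)
open import Relation.Nullary using (yes; no)

-- With fuel n this is exact for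
-- every n ≥ 1 (since 2^ν(n) ≤ n).  Convention ν₂ 0 = 0 (never used below,
-- as only ν₂ (i+1) with i ≥ 1 occurs).
ν₂-go : ℕ → ℕ → ℕ
ν₂-go zero    n = 0
ν₂-go (suc f) zero = 0
ν₂-go (suc f) (suc m) with (suc m) % 2 ≟ 0
... | yes _ = suc (ν₂-go f ((suc m) / 2))
... | no  _ = 0

ν₂ : ℕ → ℕ
ν₂ n = ν₂-go n n

-- An eventually-zero sequence u = (u₁, u₂, …) is represented by a finite
-- list; the list entry at (0-based) position k is u_{k+1}, and all u_i
-- beyond the list are 0.

wsum-from : ℕ → List ℕ → ℕ
wsum-from k []       = 0
wsum-from k (x ∷ xs) = k * x + wsum-from (suc k) xs

weight : List ℕ → ℕ
weight u = wsum-from 1 u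

parts : List ℕ → ℕ
parts []       = 0
parts (x ∷ xs) = x + parts xs

νsum-from : ℕ → List ℕ → ℕ
νsum-from k []       = 0
νsum-from k (x ∷ xs) = x * ν₂ (suc k) + νsum-from (suc k) xs

νu : List ℕ → ℕ
νu u = νsum-from 1 u

-- The inequality has slack  w + d − 2ν(u) = Σᵢ uᵢ ((i+1) − 2ν(i+1)),  so
-- 2(n − ν(u)) = 2(n − w) + slack + (w − d).  Each coefficient m − 2ν(m) is nonnegative:
-- if m = 2h then 2ν(m) = 2 + 2ν(h) ≤ 2h because ν(h) < h.  It vanishes only for m ∈ {2, 4},
-- since ν(h) + 2 ≤ h once h ≥ 3.  So equality forces n = w and uᵢ = 0 unless i + 1 ∈ {2, 4}.
module Submission where

open import Defs
open import Data.Nat as ℕ using (ℕ; zero; suc)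
open import Data.List using (List; []; _∷_; length; lookup)
open import Data.Fin using (Fin; toℕ) renaming (zero to fzero; suc to fsuc)
open import Data.Product using (_×_; _,_)
open import Data.Empty using (⊥-elim)
open import Data.Sum using (_⊎_; inj₁; inj₂)
open import Function using (_∘_)
open import Function.Bundles using (_⇔_; mk⇔)
open import Function.Properties.Equivalence using () renaming (trans to ⇔-trans; sym to ⇔-sym)
open import Data.Product.Function.NonDependent.Propositional using (_×-⇔_)
open import Relation.Binary.PropositionalEquality
  using (_≡_; _≢_; refl; sym; trans; cong; cong₂; subst; module ≡-Reasoning)

module ν₂-Bounds where

  open import Data.Nat
  open import Data.Nat.Properties
  open import Data.Nat.DivMod using (m≡m%n+[m/n]*n)
  open import Relation.Nullary using (yes; no)

  n≡2*[n/2] : ∀ n → n % 2 ≡ 0 → n ≡ 2 * (n / 2)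
  n≡2*[n/2] n even = begin
    n                     ≡⟨ m≡m%n+[m/n]*n n 2 ⟩
    n % 2 + n / 2 * 2     ≡⟨ cong (_+ n / 2 * 2) even ⟩
    n / 2 * 2             ≡⟨ *-comm (n / 2) 2 ⟩
    2 * (n / 2)           ∎
    where open ≡-Reasoning

  data ν₂-Step (f : ℕ) : ℕ → ℕ → Set where
    stop  : ∀ {n} → ν₂-Step f n 0
    halve : ∀ h → ν₂-Step f (2 * suc h) (suc (ν₂-go f (suc h)))

  ν₂-step : ∀ f n → ν₂-Step f n (ν₂-go (suc f) n)
  ν₂-step f zero = stop
  ν₂-step f (suc m) with suc m % 2 ≟ 0
  ... | no _ = stop
  ... | yes even with suc m / 2 | n≡2*[n/2] (suc m) even
  ...   | zero  | ()
  ...   | suc h | m≡2h = subst (λ n → ν₂-Step f n (suc (ν₂-go f (suc h)))) (sym m≡2h) (halve h)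

  ν₂-go< : ∀ f n → 1 ≤ n → ν₂-go f n < n
  ν₂-go< zero    n 1≤n = 1≤n
  ν₂-go< (suc f) n 1≤n with ν₂-go (suc f) n | ν₂-step f n
  ... | _ | stop    = 1≤n
  ... | _ | halve h = s≤s (≤-trans (ν₂-go< f (suc h) (s≤s z≤n)) (m<m+n h (s≤s z≤n)))

  2*ν₂-go≤ : ∀ f n → 2 * ν₂-go f n ≤ n
  2*ν₂-go≤ zero    n = z≤n
  2*ν₂-go≤ (suc f) n with ν₂-go (suc f) n | ν₂-step f n
  ... | _ | stop    = z≤n
  ... | _ | halve h = *-monoʳ-≤ 2 (ν₂-go< f (suc h) (s≤s z≤n))

  2+ν₂-go≤ : ∀ f n → 3 ≤ n → 2 + ν₂-go f n ≤ n
  2+ν₂-go≤ zero    n 3≤n = ≤-trans (n≤1+n 2) 3≤n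
  2+ν₂-go≤ (suc f) n 3≤n with ν₂-go (suc f) n | ν₂-step f n
  ... | _ | stop          = ≤-trans (n≤1+n 2) 3≤n
  ... | _ | halve zero    = ⊥-elim (<⇒≱ 3≤n ≤-refl)
  ... | _ | halve (suc g) =
    s≤s (s≤s (≤-trans (ν₂-go< f (2 + g) (s≤s z≤n)) (≤-trans (m≤m+n (2 + g) 0) (m≤n+m (1 * (2 + g)) g))))

  2*ν₂-go< : ∀ f n → 1 ≤ n → n ≢ 2 → n ≢ 4 → 2 * ν₂-go f n < n
  2*ν₂-go< zero    n 1≤n _   _   = 1≤n
  2*ν₂-go< (suc f) n 1≤n n≢2 n≢4 with ν₂-go (suc f) n | ν₂-step f n
  ... | _ | stop                = 1≤n
  ... | _ | halve zero          = ⊥-elim (n≢2 refl)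
  ... | _ | halve (suc zero)    = ⊥-elim (n≢4 refl)
  ... | _ | halve (suc (suc g)) = *-monoʳ-< 2 (2+ν₂-go≤ f (3 + g) (s≤s (s≤s (s≤s z≤n))))

  ν₂-slack : ℕ → ℕ
  ν₂-slack n = n ∸ 2 * ν₂ n

  2*ν₂+ν₂-slack : ∀ n → 2 * ν₂ n + ν₂-slack n ≡ n
  2*ν₂+ν₂-slack n = m+[n∸m]≡n (2*ν₂-go≤ n n)

  ν₂-slack≡0⇒ : ∀ k → ν₂-slack (suc k) ≡ 0 → k ≡ 1 ⊎ k ≡ 3
  ν₂-slack≡0⇒ k slack≡0 with k ≟ 1 | k ≟ 3
  ... | yes k≡1 | _       = inj₁ k≡1
  ... | no _    | yes k≡3 = inj₂ k≡3
  ... | no k≢1  | no k≢3  = ⊥-elim (<⇒≱ 2ν<1+k (m∸n≡0⇒m≤n slack≡0))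
    where
    2ν<1+k : 2 * ν₂ (suc k) < suc k
    2ν<1+k = 2*ν₂-go< (suc k) (suc k) (s≤s z≤n) (k≢1 ∘ suc-injective) (k≢3 ∘ suc-injective)

open ν₂-Bounds using (ν₂-slack; 2*ν₂+ν₂-slack; ν₂-slack≡0⇒)

module SlackSum where

  open import Data.Nat
  open import Data.Nat.Properties
  open import Data.Nat.Tactic.RingSolver using (solve-∀)
  open import Relation.Nullary using (yes; no)

  slack-from : ℕ → List ℕ → ℕ
  slack-from k []       = 0
  slack-from k (x ∷ xs) = x * ν₂-slack (suc k) + slack-from (suc k) xs

  2*νsum+slack : ∀ k u → 2 * νsum-from k u + slack-from k u ≡ wsum-from k u + parts u
  2*νsum+slack k []       = refl
  2*νsum+slack k (x ∷ xs) = begin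
    2 * (x * v + V) + (x * s + S)  ≡⟨ regroup x v V s S ⟩
    x * (2 * v + s) + (2 * V + S)  ≡⟨ cong₂ _+_ (cong (x *_) (2*ν₂+ν₂-slack (suc k))) (2*νsum+slack (suc k) xs) ⟩
    x * suc k + (W + P)            ≡⟨ unfold x k W P ⟩
    (k * x + W) + (x + P)          ∎
    where
    open ≡-Reasoning
    v = ν₂ (suc k)
    s = ν₂-slack (suc k)
    V = νsum-from (suc k) xs
    S = slack-from (suc k) xs
    W = wsum-from (suc k) xs
    P = parts xs
    regroup : ∀ x v V s S → 2 * (x * v + V) + (x * s + S) ≡ x * (2 * v + s) + (2 * V + S)
    regroup = solve-∀
    unfold : ∀ x k W P → x * suc k + (W + P) ≡ (k * x + W) + (x + P)
    unfold = solve-∀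

  m+n≡0⇔ : ∀ m n → m + n ≡ 0 ⇔ (m ≡ 0 × n ≡ 0)
  m+n≡0⇔ m n = mk⇔ (λ m+n≡0 → m+n≡0⇒m≡0 m m+n≡0 , m+n≡0⇒n≡0 m m+n≡0) (λ { (refl , refl) → refl })

  *-ν₂-slack≡0⇔ : ∀ k x → x * ν₂-slack (suc k) ≡ 0 ⇔ (k ≢ 1 → k ≢ 3 → x ≡ 0)
  *-ν₂-slack≡0⇔ k x = mk⇔ to from
    where
    to : x * ν₂-slack (suc k) ≡ 0 → k ≢ 1 → k ≢ 3 → x ≡ 0
    to product≡0 k≢1 k≢3 with m*n≡0⇒m≡0∨n≡0 x product≡0
    ... | inj₁ x≡0     = x≡0
    ... | inj₂ slack≡0 with ν₂-slack≡0⇒ k slack≡0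
    ...   | inj₁ k≡1 = ⊥-elim (k≢1 k≡1)
    ...   | inj₂ k≡3 = ⊥-elim (k≢3 k≡3)
    from : (k ≢ 1 → k ≢ 3 → x ≡ 0) → x * ν₂-slack (suc k) ≡ 0
    from vanishes with k ≟ 1 | k ≟ 3
    ... | yes refl | _        = *-zeroʳ x
    ... | no _     | yes refl = *-zeroʳ x
    ... | no k≢1   | no k≢3 rewrite vanishes k≢1 k≢3 = refl

  PartSizes1Or3 : ℕ → List ℕ → Set
  PartSizes1Or3 k u = (j : Fin (length u)) → k + toℕ j ≢ 1 → k + toℕ j ≢ 3 → lookup u j ≡ 0

  PartSizes1Or3-∷⇔ : ∀ k x xs →
                     PartSizes1Or3 k (x ∷ xs) ⇔ ((k ≢ 1 → k ≢ 3 → x ≡ 0) × PartSizes1Or3 (suc k) xs)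
  PartSizes1Or3-∷⇔ k x xs = mk⇔ to from
    where
    to : PartSizes1Or3 k (x ∷ xs) → (k ≢ 1 → k ≢ 3 → x ≡ 0) × PartSizes1Or3 (suc k) xs
    to p = (λ k≢1 k≢3 → p fzero (k≢1 ∘ trans (sym (+-identityʳ k))) (k≢3 ∘ trans (sym (+-identityʳ k))))
         , (λ j ≢1 ≢3 → p (fsuc j) (≢1 ∘ trans (sym (+-suc k (toℕ j)))) (≢3 ∘ trans (sym (+-suc k (toℕ j)))))
    from : (k ≢ 1 → k ≢ 3 → x ≡ 0) × PartSizes1Or3 (suc k) xs → PartSizes1Or3 k (x ∷ xs)
    from (head , tail) fzero    ≢1 ≢3 = head (≢1 ∘ trans (+-identityʳ k)) (≢3 ∘ trans (+-identityʳ k))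
    from (head , tail) (fsuc j) ≢1 ≢3 = tail j (≢1 ∘ trans (+-suc k (toℕ j))) (≢3 ∘ trans (+-suc k (toℕ j)))

  slack-from≡0⇔ : ∀ k u → slack-from k u ≡ 0 ⇔ PartSizes1Or3 k u
  slack-from≡0⇔ k []       = mk⇔ (λ _ ()) (λ _ → refl)
  slack-from≡0⇔ k (x ∷ xs) =
    ⇔-trans (m+n≡0⇔ _ _)
      (⇔-trans (*-ν₂-slack≡0⇔ k x ×-⇔ slack-from≡0⇔ (suc k) xs) (⇔-sym (PartSizes1Or3-∷⇔ k x xs)))

open SlackSum using (slack-from; 2*νsum+slack; PartSizes1Or3; slack-from≡0⇔)

open import Data.Integer using (ℤ; +_; _-_; _*_; _+_; _≤_; 0ℤ; +≤+)
import Data.Integer.Properties as ℤ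
open import Data.Integer.Tactic.RingSolver using (solve-∀)
open import Algebra.Properties.AbelianGroup ℤ.+-0-abelianGroup using (identityˡ-unique)
open import Function.Related.Propositional using (module EquationalReasoning)

2*[n-v]≡2*[n-w]+e+[w-d] : ∀ (n : ℤ) (w d v e : ℕ) → 2 ℕ.* v ℕ.+ e ≡ w ℕ.+ d →
           (+ 2) * (n - + v) ≡ ((+ 2) * (n - + w) + + e) + (+ w - + d)
2*[n-v]≡2*[n-w]+e+[w-d] n w d v e 2v+e≡w+d = begin
  (+ 2) * (n - + v)                          ≡⟨ regroup n (+ w) (+ d) (+ v) (+ e) ⟩
  r + ((+ w + + d) - ((+ 2) * + v + + e))    ≡⟨ cong (λ z → r + ((+ w + + d) - z)) 2v+e≡w+dℤ ⟩
  r + ((+ w + + d) - (+ w + + d))            ≡⟨ cong (λ z → r + z) (ℤ.+-inverseʳ (+ w + + d)) ⟩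
  r + 0ℤ                                     ≡⟨ ℤ.+-identityʳ r ⟩
  r                                          ∎
  where
  open ≡-Reasoning
  r = ((+ 2) * (n - + w) + + e) + (+ w - + d)
  regroup : ∀ n w d v e → (+ 2) * (n - v) ≡ ((+ 2) * (n - w) + e) + (w - d) + ((w + d) - ((+ 2) * v + e))
  regroup = solve-∀
  2v+e≡w+dℤ : (+ 2) * + v + + e ≡ + w + + d
  2v+e≡w+dℤ = begin
    (+ 2) * + v + + e ≡⟨ cong (_+ + e) (ℤ.pos-* 2 v) ⟨
    + (2 ℕ.* v) + + e ≡⟨ ℤ.pos-+ (2 ℕ.* v) e ⟨
    + (2 ℕ.* v ℕ.+ e) ≡⟨ cong +_ 2v+e≡w+d ⟩
    + (w ℕ.+ d)       ≡⟨ ℤ.pos-+ w d ⟩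
    + w + + d         ∎

2*s+e≡0⇔ : ∀ {s : ℤ} (e : ℕ) → 0ℤ ≤ s → ((+ 2) * s + + e ≡ 0ℤ ⇔ (s ≡ 0ℤ × e ≡ 0))
2*s+e≡0⇔ {+ zero}  e (+≤+ _) = mk⇔ (λ e≡0 → refl , ℤ.+-injective e≡0) (λ { (_ , refl) → refl })
2*s+e≡0⇔ {+ suc t} e (+≤+ _) = mk⇔ (λ ()) (λ { (() , _) })

theorem6p1 : (u : List ℕ) (n : ℤ) → + weight u ≤ n →
  ((+ 2) * (n - + weight u) + (+ weight u - + parts u) ≤ (+ 2) * (n - + νu u))
  × (((+ 2) * (n - + νu u) ≡ + weight u - + parts u)
     ⇔ ((n ≡ + weight u)
        × ((k : Fin (length u)) → suc (toℕ k) ≢ 1 → suc (toℕ k) ≢ 3 → lookup u k ≡ 0)))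
theorem6p1 u n w≤n = bound , equality
  where
  w = + weight u
  w-d = + weight u - + parts u
  e = slack-from 1 u
  key : (+ 2) * (n - + νu u) ≡ ((+ 2) * (n - w) + + e) + w-d
  key = 2*[n-v]≡2*[n-w]+e+[w-d] n (weight u) (parts u) (νu u) e (2*νsum+slack 1 u)
  bound : (+ 2) * (n - w) + w-d ≤ (+ 2) * (n - + νu u)
  bound = subst ((+ 2) * (n - w) + w-d ≤_) (sym key) (ℤ.+-monoˡ-≤ w-d (ℤ.i≤i+j ((+ 2) * (n - w)) (+ e)))
  open EquationalReasoning
  equality : ((+ 2) * (n - + νu u) ≡ w-d) ⇔ (n ≡ w × PartSizes1Or3 1 u)
  equality = begin
    ((+ 2) * (n - + νu u) ≡ w-d)          ∼⟨ mk⇔ (trans (sym key)) (trans key) ⟩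
    (((+ 2) * (n - w) + + e) + w-d ≡ w-d) ∼⟨ mk⇔ (identityˡ-unique _ _)
                                                  (λ x≡0 → trans (cong (_+ w-d) x≡0) (ℤ.+-identityˡ w-d)) ⟩
    ((+ 2) * (n - w) + + e ≡ 0ℤ)          ∼⟨ 2*s+e≡0⇔ e (ℤ.i≤j⇒0≤j-i w≤n) ⟩
    (n - w ≡ 0ℤ × e ≡ 0)                  ∼⟨ mk⇔ (ℤ.i-j≡0⇒i≡j n w) ℤ.i≡j⇒i-j≡0 ×-⇔ slack-from≡0⇔ 1 u ⟩
    (n ≡ w × PartSizes1Or3 1 u)           ∎
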